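{- Let $A$ be a finite alphabet, $n$ a positive integer, and $w$ a pseudocyclic universal partial word for $A^n$. Then $w$ has well-defined diamondicity, i.e. every window of $w$ contains the same number of occurrences of $\diamond$.
   Context: A partial word over $A$ is a finite sequence of characters from $A \cup \{\diamond\}$, where $\diamond \notin A$ is a wild-card symbol; a word over $A$ contains no $\diamond$. $A^n$ denotes the set of words of length $n$ over $A$. For $x = x_1\cdots x_n \in A^n$ and a partial word $w = w_1\cdots w_N$, the position $i$ ($0 \le i \le N-n$) covers $x$ if $x_j = w_{i+j}$ for every $1\le j\le n$ with $w_{i+j}\in A$. A universal partial word for $A^n$ is a partial word $w$ such that every word in $A^n$ is covered by exactly one position of $w$. A window of $w$ is a string of $n$ consecutive characters of $w$. A partial word $w$ is pseudocyclic (with respect to $n$) if its first $n-1$ characters are equal, as a string over $A\cup\{\diamond\}$, to its last $n-1$ characters (these two strings may overlap in $w$). -}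

module Defs where

open import Data.Nat using (ℕ; zero; suc; _+_; _∸_; _≤_)
open import Data.Fin using (Fin)
open import Data.Maybe using (Maybe; just; nothing)
open import Data.List using (List; []; _∷_; length; take; drop)
open import Data.Vec using (Vec; []; _∷_)
open import Data.Product using (Σ; _×_; _,_)
open import Data.Unit using (⊤)
open import Data.Empty using (⊥)
open import Relation.Binary.PropositionalEquality using (_≡_)

-- Alphabet A = Fin k (an arbitrary finite alphabet).
-- A partial word over Fin k: `nothing` is the wild-card ◇, `just a` is the letter a.
PartialWord : ℕ → Set
PartialWord k = List (Maybe (Fin k))

Word : ℕ → ℕ → Set
Word k n = Vec (Fin k) n

Compatible : ∀ {k n} → Word k n → List (Maybe (Fin k)) → Set
Compatible []       _              = ⊤
Compatible (_ ∷ _)  []             = ⊥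
Compatible (a ∷ x)  (nothing ∷ u)  = Compatible x u
Compatible (a ∷ x)  (just b ∷ u)   = (a ≡ b) × Compatible x u

window : ∀ {k} → ℕ → PartialWord k → ℕ → List (Maybe (Fin k))
window n w i = take n (drop i w)

Covers : ∀ {k n} → PartialWord k → ℕ → Word k n → Set
Covers {n = n} w i x = (i + n ≤ length w) × Compatible x (window n w i)

Universal : (k n : ℕ) → PartialWord k → Set
Universal k n w =
  (x : Word k n) → Σ ℕ λ i → Covers w i x × ((j : ℕ) → Covers w j x → j ≡ i)

Pseudocyclic : ∀ {k} → ℕ → PartialWord k → Set
Pseudocyclic n w =
  (n ∸ 1 ≤ length w) × (take (n ∸ 1) w ≡ drop (length w ∸ (n ∸ 1)) w)

diamonds : ∀ {k} → List (Maybe (Fin k)) → ℕ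
diamonds []             = 0
diamonds (nothing ∷ u)  = suc (diamonds u)
diamonds (just _ ∷ u)   = diamonds u

WellDefinedDiamondicity : ∀ {k} → ℕ → PartialWord k → Set
WellDefinedDiamondicity n w =
  (i j : ℕ) → i + n ≤ length w → j + n ≤ length w →
  diamonds (window n w i) ≡ diamonds (window n w j)

-- Sliding a window one step to the right drops w[i] and adds w[i+n+1], so it suffices that
-- these two characters are both letters or both ◇.  Suppose w[i] = c is a letter and
-- w[i+n+1] = ◇.  Pick y compatible with w[i+1 .. i+n] and a letter a ≠ c, and let j be the
-- window covering a·y.  Then y fits at j + 1, and extending it to the right there (or at 0
-- when j + 1 is the last n-window, by pseudocyclicity) gives a word that is also covered at
-- i + 1, because ◇ at i + n + 1 accepts any last letter; uniqueness forces j = i, against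
-- a ≠ c.  The case w[i] = ◇, w[i+n+1] = c is the mirror image, extending to the left.  When
-- |A| = 1 there is no letter a, but then the only word of A^(n+1) is covered by every
-- window, so there is just one window.

module Submission where

open import Defs
open import Data.Nat using (ℕ; zero; suc; _+_; _∸_; _≤_; _<_; s≤s)
open import Data.Nat.Properties
open import Data.Fin using (Fin; punchIn) renaming (zero to fzero)
open import Data.Fin.Properties using (punchInᵢ≢i)
open import Data.Maybe using (Maybe; just; nothing)
open import Data.List using (List; []; _∷_; [_]; length; take; drop)
open import Data.List.Properties using (drop-drop)
open import Data.Vec using ([]; _∷_; _∷ʳ_; replicate)
open import Data.Product using (∃; ∃₂; _,_; proj₁; proj₂)
open import Data.Sum using (inj₁; inj₂)
open import Data.Unit using (⊤; tt)
open import Data.Empty using (⊥; ⊥-elim)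
open import Function using (_∘_)
open import Relation.Binary.PropositionalEquality
  using (_≡_; _≢_; refl; sym; trans; cong; subst; subst₂; module ≡-Reasoning)

private
  variable
    A : Set
    k m : ℕ

m+1+n≤o⇒m+n<o : ∀ m {n o} → m + suc n ≤ o → m + n < o
m+1+n≤o⇒m+n<o m {n} {o} = subst (_≤ o) (+-suc m n)

m+n<o⇒m+1+n≤o : ∀ m {n o} → m + n < o → m + suc n ≤ o
m+n<o⇒m+1+n≤o m {n} {o} = subst (_≤ o) (sym (+-suc m n))

drop-∷ : ∀ p (u : List A) {c r} → drop p u ≡ c ∷ r → drop (suc p) u ≡ r
drop-∷ zero    (x ∷ u) refl = refl
drop-∷ (suc p) (x ∷ u) e    = drop-∷ p u e

drop-nonempty : ∀ p (u : List A) → p < length u → ∃₂ λ c r → drop p u ≡ c ∷ r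
drop-nonempty zero    (x ∷ u) _       = x , u , refl
drop-nonempty (suc p) (x ∷ u) (s≤s p<) = drop-nonempty p u p<

≤-length-drop : ∀ p (u : List A) → p + m ≤ length u → m ≤ length (drop p u)
≤-length-drop zero    u       v       = v
≤-length-drop (suc p) (x ∷ u) (s≤s v) = ≤-length-drop p u v

diamonds-∷ : ∀ c (u : PartialWord k) → diamonds (c ∷ u) ≡ diamonds [ c ] + diamonds u
diamonds-∷ nothing  u = refl
diamonds-∷ (just _) u = refl

diamonds-take-suc : ∀ m (u : PartialWord k) {c r} → drop m u ≡ c ∷ r →
  diamonds (take (suc m) u) ≡ diamonds (take m u) + diamonds [ c ]
diamonds-take-suc zero    (nothing ∷ u) refl = refl
diamonds-take-suc zero    (just _ ∷ u)  refl = refl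
diamonds-take-suc (suc m) (nothing ∷ u) e    = cong suc (diamonds-take-suc m u e)
diamonds-take-suc (suc m) (just _ ∷ u)  e    = diamonds-take-suc m u e

diamonds-window-shift : ∀ n i (w : PartialWord k) {c₀ r₀ c₁ r₁} →
  drop i w ≡ c₀ ∷ r₀ → drop (suc i + n) w ≡ c₁ ∷ r₁ → diamonds [ c₀ ] ≡ diamonds [ c₁ ] →
  diamonds (window (suc n) w i) ≡ diamonds (window (suc n) w (suc i))
diamonds-window-shift n i w {c₀} {r₀} {c₁} e₀ e₁ same = begin
  diamonds (take (suc n) (drop i w))       ≡⟨ cong (diamonds ∘ take (suc n)) e₀ ⟩
  diamonds (c₀ ∷ take n r₀)                ≡⟨ diamonds-∷ c₀ (take n r₀) ⟩
  diamonds [ c₀ ] + diamonds (take n r₀)   ≡⟨ cong (_+ diamonds (take n r₀)) same ⟩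
  diamonds [ c₁ ] + diamonds (take n r₀)   ≡⟨ +-comm (diamonds [ c₁ ]) _ ⟩
  diamonds (take n r₀) + diamonds [ c₁ ]   ≡⟨ diamonds-take-suc n r₀ last ⟨
  diamonds (take (suc n) r₀)               ≡⟨ cong (diamonds ∘ take (suc n)) tail ⟨
  diamonds (take (suc n) (drop (suc i) w)) ∎
  where
  open ≡-Reasoning
  tail : drop (suc i) w ≡ r₀
  tail = drop-∷ i w e₀
  last : drop n r₀ ≡ c₁ ∷ _
  last = trans (cong (drop n) (sym tail)) (trans (drop-drop (suc i) n w) e₁)

diamondicity-by-sliding : ∀ m (w : PartialWord k) →
  (∀ i → suc i + m ≤ length w → diamonds (window m w i) ≡ diamonds (window m w (suc i))) →
  WellDefinedDiamondicity m w
diamondicity-by-sliding m w slide i j vi vj = trans (to-start i vi) (sym (to-start j vj))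
  where
  to-start : ∀ i → i + m ≤ length w → diamonds (window m w i) ≡ diamonds (window m w 0)
  to-start zero    _ = refl
  to-start (suc i) v = trans (sym (slide i v)) (to-start i (≤-trans (n≤1+n _) v))

Matches : Fin k → Maybe (Fin k) → Set
Matches a nothing  = ⊤
Matches a (just b) = a ≡ b

matching-letter : Fin k → (c : Maybe (Fin k)) → ∃ λ a → Matches a c
matching-letter d nothing  = d , tt
matching-letter _ (just b) = b , refl

module _ {a : Fin k} {x : Word k m} where

  compatible-∷ : ∀ {c u} → Matches a c → Compatible x u → Compatible (a ∷ x) (c ∷ u)
  compatible-∷ {c = nothing} _ cx = cx
  compatible-∷ {c = just _}  m cx = m , cx

  compatible-head : ∀ {c u} → Compatible (a ∷ x) (c ∷ u) → Matches a c
  compatible-head {c = nothing} _       = tt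
  compatible-head {c = just _}  (m , _) = m

  compatible-tail : ∀ j (u : PartialWord k) →
    Compatible (a ∷ x) (drop j u) → Compatible x (drop (suc j) u)
  compatible-tail zero    (nothing ∷ u) cx       = cx
  compatible-tail zero    (just _ ∷ u)  (_ , cx) = cx
  compatible-tail (suc j) (_ ∷ u)       cx       = compatible-tail j u cx

compatible-take : (x : Word k m) (u : PartialWord k) → Compatible x u → Compatible x (take m u)
compatible-take []      u             _        = tt
compatible-take (a ∷ x) (nothing ∷ u) cx       = compatible-take x u cx
compatible-take (a ∷ x) (just _ ∷ u)  (m , cx) = m , compatible-take x u cx

compatible-take⁻ : (x : Word k m) (u : PartialWord k) → Compatible x (take m u) → Compatible x u
compatible-take⁻ []      u             _        = tt
compatible-take⁻ (a ∷ x) (nothing ∷ u) cx       = compatible-take⁻ x u cx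
compatible-take⁻ (a ∷ x) (just _ ∷ u)  (m , cx) = m , compatible-take⁻ x u cx

compatible-∷ʳ : ∀ {a} (x : Word k m) u {c r} →
  Compatible x u → drop m u ≡ c ∷ r → Matches a c → Compatible (x ∷ʳ a) u
compatible-∷ʳ []      (c ∷ u)       _        refl ma = compatible-∷ ma tt
compatible-∷ʳ (_ ∷ x) (nothing ∷ u) cx       e    ma = compatible-∷ʳ x u cx e ma
compatible-∷ʳ (_ ∷ x) (just _ ∷ u)  (m , cx) e    ma = m , compatible-∷ʳ x u cx e ma

compatible-init : ∀ {a} (x : Word k m) u → Compatible (x ∷ʳ a) u → Compatible x u
compatible-init []      u             _        = tt
compatible-init (_ ∷ x) (nothing ∷ u) cx       = compatible-init x u cx
compatible-init (_ ∷ x) (just _ ∷ u)  (m , cx) = m , compatible-init x u cx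

compatible-last : ∀ {a} (x : Word k m) u {c r} →
  Compatible (x ∷ʳ a) u → drop m u ≡ c ∷ r → Matches a c
compatible-last []      (c ∷ u)       cx       refl = compatible-head cx
compatible-last (_ ∷ x) (nothing ∷ u) cx       e    = compatible-last x u cx e
compatible-last (_ ∷ x) (just _ ∷ u)  (_ , cx) e    = compatible-last x u cx e

compatible-word : Fin k → (u : PartialWord k) → m ≤ length u → ∃ λ (x : Word k m) → Compatible x u
compatible-word {m = zero}  d u       _       = [] , tt
compatible-word {m = suc m} d (c ∷ u) (s≤s v) =
  let a , ma = matching-letter d c
      x , cx = compatible-word d u v
  in a ∷ x , compatible-∷ ma cx

compatible-unary : (x : Word 1 m) (u : PartialWord 1) → m ≤ length u → Compatible x u
compatible-unary []          u                _       = tt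
compatible-unary (fzero ∷ x) (nothing ∷ u)    (s≤s v) = compatible-unary x u v
compatible-unary (fzero ∷ x) (just fzero ∷ u) (s≤s v) = refl , compatible-unary x u v

-- drop p w ≡ c ∷ r says w[p] = c, and Compatible x (drop p w) says that x fits at position p;
-- Covers w p x adds that the window at p lies inside w.
module Covering (w : PartialWord k) where

  covers : ∀ p (x : Word k m) → p + m ≤ length w → Compatible x (drop p w) → Covers w p x
  covers p x v cx = v , compatible-take x (drop p w) cx

  covers⁻ : ∀ p (x : Word k m) → Covers w p x → Compatible x (drop p w)
  covers⁻ p x (_ , cx) = compatible-take⁻ x (drop p w) cx

  covers-∷ : ∀ p {c r} a (x : Word k m) → p + suc m ≤ length w →
    drop p w ≡ c ∷ r → Matches a c → Compatible x (drop (suc p) w) → Covers w p (a ∷ x)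
  covers-∷ p a x v e ma cx =
    covers p (a ∷ x) v
      (subst (Compatible (a ∷ x)) (sym e) (compatible-∷ ma (subst (Compatible x) (drop-∷ p w e) cx)))

  covers-∷ʳ : ∀ p {c r} a (x : Word k m) → p + suc m ≤ length w →
    Compatible x (drop p w) → drop (p + m) w ≡ c ∷ r → Matches a c → Covers w p (x ∷ʳ a)
  covers-∷ʳ {m = m} p a x v cx e ma =
    covers p (x ∷ʳ a) v (compatible-∷ʳ x (drop p w) cx (trans (drop-drop p m w) e) ma)

  covers-head : ∀ p {c r} a (x : Word k m) → Covers w p (a ∷ x) → drop p w ≡ c ∷ r → Matches a c
  covers-head p a x cov e = compatible-head (subst (Compatible (a ∷ x)) e (covers⁻ p (a ∷ x) cov))

  covers-tail : ∀ p a (x : Word k m) → Covers w p (a ∷ x) → Compatible x (drop (suc p) w)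
  covers-tail p a x cov = compatible-tail p w (covers⁻ p (a ∷ x) cov)

  covers-init : ∀ p a (x : Word k m) → Covers w p (x ∷ʳ a) → Compatible x (drop p w)
  covers-init p a x cov = compatible-init x (drop p w) (covers⁻ p (x ∷ʳ a) cov)

  covers-last : ∀ p {c r} a (x : Word k m) → Covers w p (x ∷ʳ a) → drop (p + m) w ≡ c ∷ r → Matches a c
  covers-last {m = m} p a x cov e =
    compatible-last x (drop p w) (covers⁻ p (x ∷ʳ a) cov) (trans (drop-drop p m w) e)

  word-fitting-at : Fin k → ∀ p → p + m ≤ length w → ∃ λ (x : Word k m) → Compatible x (drop p w)
  word-fitting-at d p v = compatible-word d (drop p w) (≤-length-drop p w v)

  covers-unique : Universal k m w → ∀ {i j} (x : Word k m) → Covers w i x → Covers w j x → i ≡ j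
  covers-unique U x ci cj = let _ , _ , only = U x in trans (only _ ci) (sym (only _ cj))

unary-unique-position : {w : PartialWord 1} → Universal 1 m w →
  ∀ {i j} → i + m ≤ length w → j + m ≤ length w → i ≡ j
unary-unique-position {m = m} {w} U vi vj =
  covers-unique U (replicate m fzero) (covering vi) (covering vj)
  where
  open Covering w
  covering : ∀ {p} → p + m ≤ length w → Covers w p (replicate m fzero)
  covering {p} v =
    covers p (replicate m fzero) v
      (compatible-unary (replicate m fzero) (drop p w) (≤-length-drop p w v))

module _ {n} {w : PartialWord k} (U : Universal k (suc n) w) where

  open Covering w

  right-extension-unique : Fin k → ∀ {q i} (y : Word k n) → Compatible y (drop q w) →
    q + suc n ≤ length w → (∀ e → Covers w i (y ∷ʳ e)) → q ≡ i
  right-extension-unique d {q} y cy v covered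
    with c , _ , e ← drop-nonempty (q + n) w (m+1+n≤o⇒m+n<o q v) =
    let a , ma = matching-letter d c in
    covers-unique U (y ∷ʳ a) (covers-∷ʳ q a y v cy e ma) (covered a)

  left-extension-unique : Fin k → ∀ {q i} (y : Word k n) → Compatible y (drop (suc q) w) →
    q + suc n ≤ length w → (∀ e → Covers w i (e ∷ y)) → q ≡ i
  left-extension-unique d {q} y cy v covered
    with c , _ , e ← drop-nonempty q w (m+n≤o⇒m≤o (suc q) (m+1+n≤o⇒m+n<o q v)) =
    let a , ma = matching-letter d c in
    covers-unique U (a ∷ y) (covers-∷ q a y v e ma cy) (covered a)

  module _ (P : take n w ≡ drop (length w ∸ n) w) where

    private
      at-end : ∀ {p} → p + n ≡ length w → p ≡ length w ∸ n
      at-end {p} end = trans (sym (m+n∸n≡m p n)) (cong (_∸ n) end)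

    fits-at-end⇒fits-at-start : ∀ {p} (y : Word k n) →
      p + n ≡ length w → Compatible y (drop p w) → Compatible y w
    fits-at-end⇒fits-at-start y end cy =
      compatible-take⁻ y w (subst (Compatible y) (sym P)
        (subst (λ q → Compatible y (drop q w)) (at-end end) cy))

    fits-at-start⇒fits-at-end : ∀ {p} (y : Word k n) →
      p + n ≡ length w → Compatible y w → Compatible y (drop p w)
    fits-at-start⇒fits-at-end y end cy =
      subst (λ q → Compatible y (drop q w)) (sym (at-end end))
        (subst (Compatible y) P (compatible-take y w cy))

    right-extension-unique-cyclic : Fin k → ∀ {p i} (y : Word k n) → Compatible y (drop p w) →
      p + n ≤ length w → (∀ e → Covers w (suc i) (y ∷ʳ e)) → p ≡ suc i
    right-extension-unique-cyclic d {p} {i} y cy p+n≤ covered with m≤n⇒m<n∨m≡n p+n≤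
    ... | inj₁ p+n< = right-extension-unique d y cy (m+n<o⇒m+1+n≤o p p+n<) covered
    ... | inj₂ end  = ⊥-elim (0≢1+n (right-extension-unique d y (fits-at-end⇒fits-at-start y end cy)
                                         (m+n≤o⇒n≤o (suc i) (proj₁ (covered d))) covered))

    left-extension-unique-cyclic : Fin k → ∀ {p i} (y : Word k n) → Compatible y (drop p w) →
      p + n ≤ length w → suc i + suc n ≤ length w → (∀ e → Covers w i (e ∷ y)) → p ≡ suc i
    left-extension-unique-cyclic d {suc p} y cy p+n≤ _ covered =
      cong suc (left-extension-unique d y cy (m+n<o⇒m+1+n≤o p p+n≤) covered)
    left-extension-unique-cyclic d {zero} {i} y cy _ v covered =
      ⊥-elim (<-irrefl refl (+-cancelʳ-≤ (suc n) (suc s) s past-end))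
      where
      s : ℕ
      s = length w ∸ suc n
      s+ : s + suc n ≡ length w
      s+ = m∸n+n≡m (m+n≤o⇒n≤o (suc i) v)
      s≡i : s ≡ i
      s≡i = left-extension-unique d y (fits-at-start⇒fits-at-end y (trans (sym (+-suc s n)) s+) cy)
                                  (≤-reflexive s+) covered
      past-end : suc s + suc n ≤ s + suc n
      past-end = subst₂ (λ t N → suc t + suc n ≤ N) (sym s≡i) (sym s+) v

    ¬letter-then-diamond : ∀ {i c r₀ r₁} (a : Fin k) → a ≢ c → drop i w ≡ just c ∷ r₀ →
      drop (suc i + n) w ≡ nothing ∷ r₁ → suc i + suc n ≤ length w → ⊥
    ¬letter-then-diamond {i} {c} a a≢c e₀ e₁ v
      with y , cy ← word-fitting-at c (suc i) (<⇒≤ (m+1+n≤o⇒m+n<o (suc i) v))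
      with j , covⱼ , _ ← U (a ∷ y)
      with refl ← right-extension-unique-cyclic c {i = i} y (covers-tail j a y covⱼ)
                    (m+1+n≤o⇒m+n<o j (proj₁ covⱼ)) (λ e → covers-∷ʳ (suc i) e y v cy e₁ tt)
      = a≢c (covers-head j a y covⱼ e₀)

    ¬diamond-then-letter : ∀ {i c r₀ r₁} (a : Fin k) → a ≢ c → drop i w ≡ nothing ∷ r₀ →
      drop (suc i + n) w ≡ just c ∷ r₁ → suc i + suc n ≤ length w → ⊥
    ¬diamond-then-letter {i} {c} a a≢c e₀ e₁ v
      with y , cy ← word-fitting-at c (suc i) (<⇒≤ (m+1+n≤o⇒m+n<o (suc i) v))
      with j , covⱼ , _ ← U (y ∷ʳ a)
      with refl ← left-extension-unique-cyclic c {i = i} y (covers-init j a y covⱼ)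
                    (<⇒≤ (m+1+n≤o⇒m+n<o j (proj₁ covⱼ))) v
                    (λ e → covers-∷ i e y (≤-trans (n≤1+n _) v) e₀ tt cy)
      = a≢c (covers-last j a y covⱼ e₁)

    diamond-period : ((c : Fin k) → ∃ λ a → a ≢ c) → ∀ {i c₀ r₀ c₁ r₁} →
      drop i w ≡ c₀ ∷ r₀ → drop (suc i + n) w ≡ c₁ ∷ r₁ → suc i + suc n ≤ length w →
      diamonds [ c₀ ] ≡ diamonds [ c₁ ]
    diamond-period other {c₀ = nothing} {c₁ = nothing} _  _  _ = refl
    diamond-period other {c₀ = just _}  {c₁ = just _}  _  _  _ = refl
    diamond-period other {c₀ = just c}  {c₁ = nothing} e₀ e₁ v =
      ⊥-elim (¬letter-then-diamond (proj₁ (other c)) (proj₂ (other c)) e₀ e₁ v)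
    diamond-period other {c₀ = nothing} {c₁ = just c}  e₀ e₁ v =
      ⊥-elim (¬diamond-then-letter (proj₁ (other c)) (proj₂ (other c)) e₀ e₁ v)

    window-shift-preserves-diamonds : ((c : Fin k) → ∃ λ a → a ≢ c) →
      ∀ i → suc i + suc n ≤ length w →
      diamonds (window (suc n) w i) ≡ diamonds (window (suc n) w (suc i))
    window-shift-preserves-diamonds other i v
      with _ , _ , e₀ ← drop-nonempty i w (m+n≤o⇒m≤o (suc i) v)
      with _ , _ , e₁ ← drop-nonempty (suc i + n) w (m+1+n≤o⇒m+n<o (suc i) v)
      = diamonds-window-shift n i w e₀ e₁ (diamond-period other e₀ e₁ v)

another-letter : (c : Fin (suc (suc k))) → ∃ λ a → a ≢ c
another-letter c = punchIn c fzero , punchInᵢ≢i c fzero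

proposition4p5 : (k n : ℕ) → (w : PartialWord k) →
    Universal k (suc n) w → Pseudocyclic (suc n) w →
    WellDefinedDiamondicity (suc n) w
proposition4p5 zero          n w U (_ , P) =
  diamondicity-by-sliding (suc n) w (window-shift-preserves-diamonds U P λ ())
proposition4p5 (suc zero)    n w U _       i j vi vj =
  cong (diamonds ∘ window (suc n) w) (unary-unique-position U vi vj)
proposition4p5 (suc (suc k)) n w U (_ , P) =
  diamondicity-by-sliding (suc n) w (window-shift-preserves-diamonds U P another-letter)
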